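{- Let $v>k>i\ge 0$ be integers with $v\ge 2k$ and $(v,k,i)\neq(2k,k,0)$, let $X=J(v,k,i)$ and $\Delta=v-2k+2i$. Then $$\mathrm{diam}(X)= \begin{cases} \lceil \frac{k-i-1}{\Delta} \rceil+1 & \text{if } v<3(k-i)-1 \text{ or } i=0; \\ 3 & \text{if } 3(k-i)-1\leq v <3k-2i \text{ and } i\neq 0;\\ \lceil\frac{k}{k-i}\rceil & \text{if } v \geq 3k-2i \text{ and } i\neq 0. \end{cases}$$
   Context: For integers $v>k>i\ge 0$, the generalized Johnson graph $J(v,k,i)$ is the simple undirected graph whose vertices are the $k$-element subsets of a fixed $v$-element set, two vertices $A,B$ being adjacent iff $|A\cap B|=i$. $\mathrm{diam}$ denotes the diameter (maximum graph distance). -}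

module Defs where

open import Data.Nat using (ℕ; zero; suc; _+_; _∸_; _≤_; _/_)
open import Data.Fin.Subset using (Subset; _∩_; ∣_∣)
open import Data.Product using (Σ; ∃; ∃-syntax; _×_; _,_)
open import Relation.Binary.PropositionalEquality using (_≡_)

-- Ceiling division ⌈ a / b ⌉ for b > 0.  Convention: ⌈ a / 0 ⌉ = 0
-- (never used in the theorem: all divisors there are provably positive).
⌈_/_⌉ : ℕ → ℕ → ℕ
⌈ a / zero ⌉ = 0
⌈ a / suc b ⌉ = (a + b) / suc b

KSubset : ℕ → ℕ → Set
KSubset v k = Σ (Subset v) (λ A → ∣ A ∣ ≡ k)

-- Adjacency in the generalized Johnson graph J(v,k,i): |A ∩ B| = i.
-- (Since i < k, this is irreflexive, so the graph is simple.)
JAdj : (v k i : ℕ) → KSubset v k → KSubset v k → Set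
JAdj v k i (A , _) (B , _) = ∣ A ∩ B ∣ ≡ i

data Walk {V : Set} (E : V → V → Set) : V → V → ℕ → Set where
  here : ∀ {x} → Walk E x x 0
  step : ∀ {x y z n} → E x y → Walk E y z n → Walk E x z (suc n)

DistLe : {V : Set} (E : V → V → Set) → V → V → ℕ → Set
DistLe E x y d = ∃[ m ] (m ≤ d × Walk E x y m)

-- diam = d : all distances are ≤ d (in particular finite), and some pair
-- of vertices has distance exactly d (every walk between them has length ≥ d).
Diameter : {V : Set} (E : V → V → Set) → ℕ → Set
Diameter {V} E d =
  (∀ x y → DistLe E x y d) ×
  (∃[ x ] ∃[ y ] (∀ m → Walk E x y m → d ≤ m))

-- Write t for the number of points in which two vertices X, Y meet. By inclusion–exclusion, a
-- neighbour Z of X meets Y in s points only if t, s and i satisfy four linear inequalities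
-- (Step t s); conversely, when v ≥ 2k, any such s is realised by a neighbour built region by
-- region inside the Venn diagram of X and Y. Distances are thus governed by walks on meet sizes,
-- from t to k. For Δ ≥ k each step raises the meet by at most k − i, and climbing by exactly k − i
-- achieves the bound ⌈k/(k − i)⌉. For intermediate Δ, disjoint vertices need three steps and
-- three always suffice. For small Δ (or i = 0) the meets reachable in 2j steps are exactly those
-- with k − t ≤ jΔ, and in 2j + 1 steps exactly those with |t − i| ≤ jΔ; the extreme pair meets in
-- k − 1 − ⌊q/2⌋Δ points, where q = ⌈(k − i − 1)/Δ⌉.

module Submission where

open import Defs
open import Data.Nat using (ℕ; zero; suc; _+_; _*_; _∸_; _≤_; _<_; _≥_; z≤n; s≤s; _≤?_)
open import Data.Nat.Properties
open import Data.Nat.DivMod using (_/_; _%_; m≡m%n+[m/n]*n; m%n<n; m/n*n≤m; m<n*o⇒m/o<n)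
open import Data.Nat.Tactic.RingSolver using (solve)
open import Data.List using ([]; _∷_)
open import Data.Bool using (true; false)
open import Data.Fin.Subset using (Subset; _∩_; _∪_; _─_; ∁; ⊤; ∣_∣; _⊆_)
open import Data.Fin.Subset.Properties
  using (∩-comm; ∩-idem; ∩-distribʳ-∪; ∣p∩q∣≤∣p∣; ∣p∩q∣≤∣q∣; ∣p∣≤n; ∣⊤∣≡n; ∣∁p∣≡n∸∣p∣;
         p⊆q⇒∣p∣≤∣q∣; p∩q⊆q; x∈p∩q⁺; x∈p∩q⁻)
open import Data.Product using (∃; ∃-syntax; _×_; _,_; proj₁; proj₂; map₂)
open import Data.Sum using (_⊎_; inj₁; inj₂; [_,_]′; map₁)
open import Data.Empty using (⊥-elim)
open import Function using (_∘_)
open import Relation.Binary.Definitions using (tri<; tri≈; tri>)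
open import Relation.Binary.PropositionalEquality
open import Relation.Nullary using (¬_; yes; no; contradiction)
open import Algebra.Properties.CommutativeSemigroup +-commutativeSemigroup using (xy∙z≈xz∙y)

-- Linear arithmetic: add hypotheses with +-mono-≤, normalise both sides with the ring solver,
-- and cancel the common summand c.
cancel-≤ : ∀ {x y l r} c → l ≤ r → x + c ≡ l → r ≡ y + c → x ≤ y
cancel-≤ {x} {y} c l≤r refl refl = +-cancelʳ-≤ c x y l≤r

cancel-≡ : ∀ {x y l r} c → l ≡ r → x + c ≡ l → r ≡ y + c → x ≡ y
cancel-≡ {x} {y} c l≡r refl refl = +-cancelʳ-≡ c x y l≡r

x+y+z≡y+z+x : ∀ x y z → x + y + z ≡ y + z + x
x+y+z≡y+z+x x y z = trans (+-assoc x y z) (+-comm x (y + z))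

data Halving : ℕ → Set where
  even : ∀ h → Halving (h + h)
  odd  : ∀ h → Halving (suc (h + h))

halving : ∀ n → Halving n
halving zero = even 0
halving (suc n) with halving n
... | even h = odd h
... | odd h  = subst Halving (cong suc (+-suc h h)) (even (suc h))

halving-bounds : ∀ n → ∃[ h ] h + h ≤ n × n ≤ suc (h + h)
halving-bounds n with halving n
... | even h = h , ≤-refl , n≤1+n _
... | odd h  = h , n≤1+n _ , ≤-refl

a≤⌈a/d⌉*d : ∀ a {d} → 0 < d → a ≤ ⌈ a / d ⌉ * d
a≤⌈a/d⌉*d a {suc b} _ = +-cancelʳ-≤ b a (q * suc b) (begin
  a + b                       ≡⟨ m≡m%n+[m/n]*n (a + b) (suc b) ⟩
  (a + b) % suc b + q * suc b ≤⟨ +-monoˡ-≤ (q * suc b) (m<1+n⇒m≤n (m%n<n (a + b) (suc b))) ⟩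
  b + q * suc b               ≡⟨ +-comm b (q * suc b) ⟩
  q * suc b + b               ∎)
  where
  q : ℕ
  q = (a + b) / suc b
  open ≤-Reasoning

⌈a/d⌉*d<a+d : ∀ a {d} → 0 < d → ⌈ a / d ⌉ * d < a + d
⌈a/d⌉*d<a+d a {suc b} _ = ≤-<-trans (m/n*n≤m (a + b) (suc b)) (+-monoʳ-< a (n<1+n b))

⌈a/d⌉≤m : ∀ a {d} m → 0 < d → a ≤ m * d → ⌈ a / d ⌉ ≤ m
⌈a/d⌉≤m a {suc b} m _ a≤md =
  m<1+n⇒m≤n (m<n*o⇒m/o<n (s≤s (subst (a + b ≤_) (+-comm (m * suc b) b) (+-monoˡ-≤ b a≤md))))

module SubsetCounting where
  open import Data.Vec using ([]; _∷_)

  ∣p∪q∣+∣p∩q∣≡∣p∣+∣q∣ : ∀ {n} (p q : Subset n) → ∣ p ∪ q ∣ + ∣ p ∩ q ∣ ≡ ∣ p ∣ + ∣ q ∣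
  ∣p∪q∣+∣p∩q∣≡∣p∣+∣q∣ [] [] = refl
  ∣p∪q∣+∣p∩q∣≡∣p∣+∣q∣ (true ∷ p) (true ∷ q) =
    cong suc (trans (+-suc _ _) (trans (cong suc (∣p∪q∣+∣p∩q∣≡∣p∣+∣q∣ p q)) (sym (+-suc _ _))))
  ∣p∪q∣+∣p∩q∣≡∣p∣+∣q∣ (true ∷ p) (false ∷ q) = cong suc (∣p∪q∣+∣p∩q∣≡∣p∣+∣q∣ p q)
  ∣p∪q∣+∣p∩q∣≡∣p∣+∣q∣ (false ∷ p) (true ∷ q) =
    trans (cong suc (∣p∪q∣+∣p∩q∣≡∣p∣+∣q∣ p q)) (sym (+-suc _ _))
  ∣p∪q∣+∣p∩q∣≡∣p∣+∣q∣ (false ∷ p) (false ∷ q) = ∣p∪q∣+∣p∩q∣≡∣p∣+∣q∣ p q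

  ∣p∪q∣≤∣p∣+∣q∣ : ∀ {n} (p q : Subset n) → ∣ p ∪ q ∣ ≤ ∣ p ∣ + ∣ q ∣
  ∣p∪q∣≤∣p∣+∣q∣ p q = subst (∣ p ∪ q ∣ ≤_) (∣p∪q∣+∣p∩q∣≡∣p∣+∣q∣ p q) (m≤m+n _ _)

  ∣p∩q∣+∣p─q∣≡∣p∣ : ∀ {n} (p q : Subset n) → ∣ p ∩ q ∣ + ∣ p ─ q ∣ ≡ ∣ p ∣
  ∣p∩q∣+∣p─q∣≡∣p∣ [] [] = refl
  ∣p∩q∣+∣p─q∣≡∣p∣ (true ∷ p) (true ∷ q) = cong suc (∣p∩q∣+∣p─q∣≡∣p∣ p q)
  ∣p∩q∣+∣p─q∣≡∣p∣ (true ∷ p) (false ∷ q) = trans (+-suc _ _) (cong suc (∣p∩q∣+∣p─q∣≡∣p∣ p q))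
  ∣p∩q∣+∣p─q∣≡∣p∣ (false ∷ p) (true ∷ q) = ∣p∩q∣+∣p─q∣≡∣p∣ p q
  ∣p∩q∣+∣p─q∣≡∣p∣ (false ∷ p) (false ∷ q) = ∣p∩q∣+∣p─q∣≡∣p∣ p q

  ∣p∩r∣+∣q∩r∣≤∣r∣+∣p∩q∣ : ∀ {n} (p q r : Subset n) → ∣ p ∩ r ∣ + ∣ q ∩ r ∣ ≤ ∣ r ∣ + ∣ p ∩ q ∣
  ∣p∩r∣+∣q∩r∣≤∣r∣+∣p∩q∣ p q r = begin
    ∣ p ∩ r ∣ + ∣ q ∩ r ∣                         ≡⟨ sym (∣p∪q∣+∣p∩q∣≡∣p∣+∣q∣ (p ∩ r) (q ∩ r)) ⟩
    ∣ (p ∩ r) ∪ (q ∩ r) ∣ + ∣ (p ∩ r) ∩ (q ∩ r) ∣ ≤⟨ +-mono-≤ (p⊆q⇒∣p∣≤∣q∣ ⊆r) (p⊆q⇒∣p∣≤∣q∣ ⊆p∩q) ⟩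
    ∣ r ∣ + ∣ p ∩ q ∣                             ∎
    where
    open ≤-Reasoning
    ⊆r : (p ∩ r) ∪ (q ∩ r) ⊆ r
    ⊆r = subst (_⊆ r) (∩-distribʳ-∪ r p q) (p∩q⊆q (p ∪ q) r)
    ⊆p∩q : (p ∩ r) ∩ (q ∩ r) ⊆ p ∩ q
    ⊆p∩q x∈ with x∈p∩q⁻ (p ∩ r) (q ∩ r) x∈
    ... | x∈p∩r , x∈q∩r = x∈p∩q⁺ (proj₁ (x∈p∩q⁻ p r x∈p∩r) , proj₁ (x∈p∩q⁻ q r x∈q∩r))

  ∣p∣+∣q∣+∣r∣≤n+∣p∩q∣+∣r∩q∣+∣p∩r∣ : ∀ {n} (p q r : Subset n) →
    ∣ p ∣ + ∣ q ∣ + ∣ r ∣ ≤ n + (∣ p ∩ q ∣ + ∣ r ∩ q ∣ + ∣ p ∩ r ∣)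
  ∣p∣+∣q∣+∣r∣≤n+∣p∩q∣+∣r∩q∣+∣p∩r∣ {n} p q r = begin
    ∣ p ∣ + ∣ q ∣ + ∣ r ∣
      ≡⟨ xy∙z≈xz∙y (∣ p ∣) (∣ q ∣) (∣ r ∣) ⟩
    ∣ p ∣ + ∣ r ∣ + ∣ q ∣
      ≡⟨ cong (_+ ∣ q ∣) (sym (∣p∪q∣+∣p∩q∣≡∣p∣+∣q∣ p r)) ⟩
    ∣ p ∪ r ∣ + ∣ p ∩ r ∣ + ∣ q ∣
      ≡⟨ xy∙z≈xz∙y (∣ p ∪ r ∣) (∣ p ∩ r ∣) (∣ q ∣) ⟩
    ∣ p ∪ r ∣ + ∣ q ∣ + ∣ p ∩ r ∣
      ≡⟨ cong (_+ ∣ p ∩ r ∣) (sym (∣p∪q∣+∣p∩q∣≡∣p∣+∣q∣ (p ∪ r) q)) ⟩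
    ∣ (p ∪ r) ∪ q ∣ + ∣ (p ∪ r) ∩ q ∣ + ∣ p ∩ r ∣
      ≡⟨ cong (λ s → ∣ (p ∪ r) ∪ q ∣ + ∣ s ∣ + ∣ p ∩ r ∣) (∩-distribʳ-∪ q p r) ⟩
    ∣ (p ∪ r) ∪ q ∣ + ∣ (p ∩ q) ∪ (r ∩ q) ∣ + ∣ p ∩ r ∣
      ≤⟨ +-monoˡ-≤ ∣ p ∩ r ∣ (+-mono-≤ (∣p∣≤n ((p ∪ r) ∪ q)) (∣p∪q∣≤∣p∣+∣q∣ (p ∩ q) (r ∩ q))) ⟩
    n + (∣ p ∩ q ∣ + ∣ r ∩ q ∣) + ∣ p ∩ r ∣
      ≡⟨ +-assoc n _ _ ⟩
    n + (∣ p ∩ q ∣ + ∣ r ∩ q ∣ + ∣ p ∩ r ∣)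
      ∎
    where open ≤-Reasoning

  ∣p∩q∣≡∣p∣≡∣q∣⇒p≡q : ∀ {n} (p q : Subset n) → ∣ p ∩ q ∣ ≡ ∣ p ∣ → ∣ p ∩ q ∣ ≡ ∣ q ∣ → p ≡ q
  ∣p∩q∣≡∣p∣≡∣q∣⇒p≡q [] [] _ _ = refl
  ∣p∩q∣≡∣p∣≡∣q∣⇒p≡q (true ∷ p) (true ∷ q) h₁ h₂ =
    cong (true ∷_) (∣p∩q∣≡∣p∣≡∣q∣⇒p≡q p q (suc-injective h₁) (suc-injective h₂))
  ∣p∩q∣≡∣p∣≡∣q∣⇒p≡q (true ∷ p) (false ∷ q) h₁ _ = contradiction h₁ (<⇒≢ (s≤s (∣p∩q∣≤∣p∣ p q)))
  ∣p∩q∣≡∣p∣≡∣q∣⇒p≡q (false ∷ p) (true ∷ q) _ h₂ = contradiction h₂ (<⇒≢ (s≤s (∣p∩q∣≤∣q∣ p q)))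
  ∣p∩q∣≡∣p∣≡∣q∣⇒p≡q (false ∷ p) (false ∷ q) h₁ h₂ = cong (false ∷_) (∣p∩q∣≡∣p∣≡∣q∣⇒p≡q p q h₁ h₂)

  select : ∀ {n} → Subset n → Subset n → (a b c d : ℕ) → Subset n
  select [] [] _ _ _ _ = []
  select (true ∷ p) (true ∷ q) zero b c d = false ∷ select p q zero b c d
  select (true ∷ p) (true ∷ q) (suc a) b c d = true ∷ select p q a b c d
  select (true ∷ p) (false ∷ q) a zero c d = false ∷ select p q a zero c d
  select (true ∷ p) (false ∷ q) a (suc b) c d = true ∷ select p q a b c d
  select (false ∷ p) (true ∷ q) a b zero d = false ∷ select p q a b zero d
  select (false ∷ p) (true ∷ q) a b (suc c) d = true ∷ select p q a b c d
  select (false ∷ p) (false ∷ q) a b c zero = false ∷ select p q a b c zero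
  select (false ∷ p) (false ∷ q) a b c (suc d) = true ∷ select p q a b c d

  select-sizes : ∀ {n} (p q : Subset n) {a b c d} →
    a ≤ ∣ p ∩ q ∣ → b ≤ ∣ p ─ q ∣ → c ≤ ∣ q ─ p ∣ → d ≤ ∣ ∁ (p ∪ q) ∣ →
    let r = select p q a b c d in
    ∣ r ∣ ≡ a + b + c + d × ∣ p ∩ r ∣ ≡ a + b × ∣ r ∩ q ∣ ≡ a + c
  select-sizes [] [] z≤n z≤n z≤n z≤n = refl , refl , refl
  select-sizes (true ∷ p) (true ∷ q) {zero} _ b≤ c≤ d≤ = select-sizes p q z≤n b≤ c≤ d≤
  select-sizes (true ∷ p) (true ∷ q) {suc a} (s≤s a≤) b≤ c≤ d≤ =
    let ∣r∣ , ∣p∩r∣ , ∣r∩q∣ = select-sizes p q a≤ b≤ c≤ d≤ in cong suc ∣r∣ , cong suc ∣p∩r∣ , cong suc ∣r∩q∣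
  select-sizes (true ∷ p) (false ∷ q) {b = zero} a≤ _ c≤ d≤ = select-sizes p q a≤ z≤n c≤ d≤
  select-sizes (true ∷ p) (false ∷ q) {a} {suc b} {c} {d} a≤ (s≤s b≤) c≤ d≤ =
    let ∣r∣ , ∣p∩r∣ , ∣r∩q∣ = select-sizes p q a≤ b≤ c≤ d≤
    in trans (cong suc ∣r∣) (sym (cong (λ x → x + c + d) (+-suc a b))) ,
       trans (cong suc ∣p∩r∣) (sym (+-suc a b)) , ∣r∩q∣
  select-sizes (false ∷ p) (true ∷ q) {c = zero} a≤ b≤ _ d≤ = select-sizes p q a≤ b≤ z≤n d≤
  select-sizes (false ∷ p) (true ∷ q) {a} {b} {suc c} {d} a≤ b≤ (s≤s c≤) d≤ =
    let ∣r∣ , ∣p∩r∣ , ∣r∩q∣ = select-sizes p q a≤ b≤ c≤ d≤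
    in trans (cong suc ∣r∣) (sym (cong (_+ d) (+-suc (a + b) c))) ,
       ∣p∩r∣ , trans (cong suc ∣r∩q∣) (sym (+-suc a c))
  select-sizes (false ∷ p) (false ∷ q) {d = zero} a≤ b≤ c≤ _ = select-sizes p q a≤ b≤ c≤ z≤n
  select-sizes (false ∷ p) (false ∷ q) {a} {b} {c} {suc d} a≤ b≤ c≤ (s≤s d≤) =
    let ∣r∣ , ∣p∩r∣ , ∣r∩q∣ = select-sizes p q a≤ b≤ c≤ d≤
    in trans (cong suc ∣r∣) (sym (+-suc (a + b + c) d)) , ∣p∩r∣ , ∣r∩q∣

  ≤∣p─q∣ : ∀ {n b} (p q : Subset n) → b + ∣ p ∩ q ∣ ≤ ∣ p ∣ → b ≤ ∣ p ─ q ∣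
  ≤∣p─q∣ {b = b} p q h =
    +-cancelʳ-≤ _ b _ (subst (b + ∣ p ∩ q ∣ ≤_) ∣p∣≡∣p─q∣+∣p∩q∣ h)
    where
    ∣p∣≡∣p─q∣+∣p∩q∣ : ∣ p ∣ ≡ ∣ p ─ q ∣ + ∣ p ∩ q ∣
    ∣p∣≡∣p─q∣+∣p∩q∣ = sym (trans (+-comm (∣ p ─ q ∣) (∣ p ∩ q ∣)) (∣p∩q∣+∣p─q∣≡∣p∣ p q))

  ≤∣∁[p∪q]∣ : ∀ {n d} (p q : Subset n) → d + (∣ p ∣ + ∣ q ∣) ≤ n + ∣ p ∩ q ∣ → d ≤ ∣ ∁ (p ∪ q) ∣
  ≤∣∁[p∪q]∣ {n} {d} p q h = subst (d ≤_) (sym (∣∁p∣≡n∸∣p∣ (p ∪ q))) (m+n≤o⇒m≤o∸n d (+-cancelʳ-≤ _ _ n (begin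
    d + ∣ p ∪ q ∣ + ∣ p ∩ q ∣   ≡⟨ +-assoc d _ _ ⟩
    d + (∣ p ∪ q ∣ + ∣ p ∩ q ∣) ≡⟨ cong (d +_) (∣p∪q∣+∣p∩q∣≡∣p∣+∣q∣ p q) ⟩
    d + (∣ p ∣ + ∣ q ∣)         ≤⟨ h ⟩
    n + ∣ p ∩ q ∣               ∎)))
    where open ≤-Reasoning

open SubsetCounting

module TripleIntersections (v k : ℕ) where

  -- For three k-subsets A, B, C of a v-set, x = ∣ A ∩ B ∣, y = ∣ C ∩ B ∣ and z = ∣ A ∩ C ∣
  -- satisfy these inequalities; when 2k ≤ v they are also sufficient for such A, B, C to exist.
  record Admissible (x y z : ℕ) : Set where
    field
      x+y≤k+z : x + y ≤ k + z
      y+z≤k+x : y + z ≤ k + x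
      x+z≤k+y : x + z ≤ k + y
      3k≤v+x+y+z : k + k + k ≤ v + (x + y + z)

  -- p is a candidate for ∣ A ∩ B ∩ C ∣.
  record Overlap (x y z p : ℕ) : Set where
    field
      p≤x : p ≤ x
      p≤y : p ≤ y
      p≤z : p ≤ z
      x+y≤k+p : x + y ≤ k + p
      y+z≤k+p : y + z ≤ k + p
      x+z≤k+p : x + z ≤ k + p
      3k+p≤v+x+y+z : k + k + k + p ≤ v + (x + y + z)

  -- Sizes of C inside the regions A ∩ B, A ─ B, B ─ A and ∁ (A ∪ B).
  record Quotas (x y z : ℕ) : Set where
    field
      a b c d : ℕ
      a+b≡z : a + b ≡ z
      a+c≡y : a + c ≡ y
      a+b+c+d≡k : a + b + c + d ≡ k
      a≤x : a ≤ x
      b+x≤k : b + x ≤ k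
      c+x≤k : c + x ≤ k
      d+k+k≤v+x : d + (k + k) ≤ v + x

  admissible-rotate : ∀ {x y z} → Admissible x y z → Admissible y z x
  admissible-rotate {x} {y} {z} a = record
    { x+y≤k+z = y+z≤k+x
    ; y+z≤k+x = subst (_≤ k + y) (+-comm x z) x+z≤k+y
    ; x+z≤k+y = subst (_≤ k + z) (+-comm x y) x+y≤k+z
    ; 3k≤v+x+y+z = subst (λ w → k + k + k ≤ v + w) (x+y+z≡y+z+x x y z) 3k≤v+x+y+z
    }
    where open Admissible a

  overlap-rotate : ∀ {x y z p} → Overlap x y z p → Overlap y z x p
  overlap-rotate {x} {y} {z} {p} o = record
    { p≤x = p≤y ; p≤y = p≤z ; p≤z = p≤x
    ; x+y≤k+p = y+z≤k+p
    ; y+z≤k+p = subst (_≤ k + p) (+-comm x z) x+z≤k+p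
    ; x+z≤k+p = subst (_≤ k + p) (+-comm x y) x+y≤k+p
    ; 3k+p≤v+x+y+z = subst (λ w → k + k + k + p ≤ v + w) (x+y+z≡y+z+x x y z) 3k+p≤v+x+y+z
    }
    where open Overlap o

  admissible⇒x≤k : ∀ {x y z} → Admissible x y z → x ≤ k
  admissible⇒x≤k {x} {y} {z} a = *-cancelˡ-≤ 2
    (cancel-≤ (y + z) (+-mono-≤ x+y≤k+z x+z≤k+y) (solve (x ∷ y ∷ z ∷ [])) (solve (k ∷ y ∷ z ∷ [])))
    where open Admissible a

  admissible⇒y≤k : ∀ {x y z} → Admissible x y z → y ≤ k
  admissible⇒y≤k = admissible⇒x≤k ∘ admissible-rotate

  admissible⇒z≤k : ∀ {x y z} → Admissible x y z → z ≤ k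
  admissible⇒z≤k = admissible⇒y≤k ∘ admissible-rotate

  -- When x is the smallest, p = max (0 , y + z - k) works.
  overlap-of-least : ∀ {x y z} → k + k ≤ v → Admissible x y z → x ≤ y → x ≤ z → ∃ (Overlap x y z)
  overlap-of-least {x} {y} {z} 2k≤v adm x≤y x≤z with y + z ≤? k
  ... | yes y+z≤k = 0 , record
    { p≤x = z≤n ; p≤y = z≤n ; p≤z = z≤n
    ; x+y≤k+p = cancel-≤ z (+-mono-≤ x≤z y+z≤k) (solve (x ∷ y ∷ z ∷ [])) (solve (z ∷ k ∷ []))
    ; y+z≤k+p = subst (y + z ≤_) (sym (+-identityʳ k)) y+z≤k
    ; x+z≤k+p = cancel-≤ y (+-mono-≤ x≤y y+z≤k) (solve (x ∷ y ∷ z ∷ [])) (solve (y ∷ k ∷ []))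
    ; 3k+p≤v+x+y+z = subst (_≤ v + (x + y + z)) (sym (+-identityʳ (k + k + k))) 3k≤v+x+y+z
    }
    where open Admissible adm
  ... | no y+z≰k with m≤n⇒∃[o]m+o≡n (<⇒≤ (≰⇒> y+z≰k))
  ...   | p , k+p≡y+z = p , record
    { p≤x = +-cancelˡ-≤ k p x (subst (_≤ k + x) (sym k+p≡y+z) y+z≤k+x)
    ; p≤y = cancel-≤ (k + z) (+-mono-≤ (≤-reflexive k+p≡y+z) (admissible⇒z≤k adm))
              (solve (p ∷ k ∷ z ∷ [])) (solve (y ∷ z ∷ k ∷ []))
    ; p≤z = cancel-≤ (k + y) (+-mono-≤ (≤-reflexive k+p≡y+z) (admissible⇒y≤k adm))
              (solve (p ∷ k ∷ y ∷ [])) (solve (y ∷ z ∷ k ∷ []))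
    ; x+y≤k+p = cancel-≤ z (+-mono-≤ x≤z (≤-reflexive (sym k+p≡y+z)))
              (solve (x ∷ y ∷ z ∷ [])) (solve (z ∷ k ∷ p ∷ []))
    ; y+z≤k+p = ≤-reflexive (sym k+p≡y+z)
    ; x+z≤k+p = cancel-≤ y (+-mono-≤ x≤y (≤-reflexive (sym k+p≡y+z)))
              (solve (x ∷ y ∷ z ∷ [])) (solve (y ∷ k ∷ p ∷ []))
    ; 3k+p≤v+x+y+z = cancel-≤ 0 (+-mono-≤ (+-mono-≤ 2k≤v (≤-reflexive k+p≡y+z)) (z≤n {x}))
              (solve (k ∷ p ∷ [])) (solve (v ∷ x ∷ y ∷ z ∷ []))
    }
    where open Admissible adm

  admissible⇒overlap : ∀ {x y z} → k + k ≤ v → Admissible x y z → ∃ (Overlap x y z)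
  admissible⇒overlap {x} {y} {z} 2k≤v adm with ≤-total x y | ≤-total x z | ≤-total y z
  ... | inj₁ x≤y | inj₁ x≤z | _ = overlap-of-least 2k≤v adm x≤y x≤z
  ... | inj₁ x≤y | inj₂ z≤x | _ =
    map₂ overlap-rotate
      (overlap-of-least 2k≤v (admissible-rotate (admissible-rotate adm)) z≤x (≤-trans z≤x x≤y))
  ... | inj₂ y≤x | _ | inj₁ y≤z =
    map₂ (overlap-rotate ∘ overlap-rotate) (overlap-of-least 2k≤v (admissible-rotate adm) y≤z y≤x)
  ... | inj₂ y≤x | _ | inj₂ z≤y =
    map₂ overlap-rotate
      (overlap-of-least 2k≤v (admissible-rotate (admissible-rotate adm)) (≤-trans z≤y y≤x) z≤y)

  overlap⇒quotas : ∀ {x y z p} → Overlap x y z p → Quotas x y z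
  overlap⇒quotas {x} {y} {z} {p} o
    with m≤n⇒∃[o]m+o≡n (Overlap.p≤z o) | m≤n⇒∃[o]m+o≡n (Overlap.p≤y o)
  ... | b , refl | c , refl with m≤n⇒∃[o]m+o≡n (Overlap.y+z≤k+p o)
  ...   | d , y+z+d≡k+p = record
    { a = p ; b = b ; c = c ; d = d
    ; a+b≡z = refl
    ; a+c≡y = refl
    ; a+b+c+d≡k = cancel-≡ p y+z+d≡k+p (solve (p ∷ b ∷ c ∷ d ∷ [])) (solve (k ∷ p ∷ []))
    ; a≤x = p≤x
    ; b+x≤k = cancel-≤ p x+z≤k+p (solve (b ∷ x ∷ p ∷ [])) (solve (k ∷ p ∷ []))
    ; c+x≤k = cancel-≤ p x+y≤k+p (solve (c ∷ x ∷ p ∷ [])) (solve (k ∷ p ∷ []))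
    ; d+k+k≤v+x = cancel-≤ (k + p + (p + c) + (p + b))
        (+-mono-≤ 3k+p≤v+x+y+z (≤-reflexive y+z+d≡k+p))
        (solve (d ∷ k ∷ p ∷ c ∷ b ∷ [])) (solve (v ∷ x ∷ p ∷ c ∷ b ∷ k ∷ []))
    }
    where open Overlap o

  admissible⇒quotas : ∀ {x y z} → k + k ≤ v → Admissible x y z → Quotas x y z
  admissible⇒quotas 2k≤v = overlap⇒quotas ∘ proj₂ ∘ admissible⇒overlap 2k≤v

module JohnsonGraph (v k i : ℕ) where
  open TripleIntersections v k public

  Vertex : Set
  Vertex = KSubset v k

  _~_ : Vertex → Vertex → Set
  _~_ = JAdj v k i

  meet : Vertex → Vertex → ℕ
  meet (A , _) (B , _) = ∣ A ∩ B ∣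

  meet≤k : ∀ X Y → meet X Y ≤ k
  meet≤k (A , ∣A∣≡k) (B , _) = subst (∣ A ∩ B ∣ ≤_) ∣A∣≡k (∣p∩q∣≤∣p∣ A B)

  meet-self : ∀ X → meet X X ≡ k
  meet-self (A , ∣A∣≡k) = trans (cong ∣_∣ (∩-idem A)) ∣A∣≡k

  -- Step t s: a vertex meeting Y in t points can move to a neighbour meeting Y in s points.
  Step : ℕ → ℕ → Set
  Step t s = Admissible t s i

  neighbour⇒step : ∀ X Y Z → X ~ Z → Step (meet X Y) (meet Z Y)
  neighbour⇒step (A , ∣A∣≡k) (B , ∣B∣≡k) (C , ∣C∣≡k) ∣A∩C∣≡i = record
    { x+y≤k+z = subst₂ (λ b c → ∣ A ∩ B ∣ + ∣ C ∩ B ∣ ≤ b + c) ∣B∣≡k ∣A∩C∣≡i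
        (∣p∩r∣+∣q∩r∣≤∣r∣+∣p∩q∣ A C B)
    ; y+z≤k+x = begin
        ∣ C ∩ B ∣ + i             ≡⟨ cong₂ _+_ (cong ∣_∣ (∩-comm C B)) (sym ∣A∩C∣≡i) ⟩
        ∣ B ∩ C ∣ + ∣ A ∩ C ∣     ≤⟨ ∣p∩r∣+∣q∩r∣≤∣r∣+∣p∩q∣ B A C ⟩
        ∣ C ∣ + ∣ B ∩ A ∣         ≡⟨ cong₂ _+_ ∣C∣≡k (cong ∣_∣ (∩-comm B A)) ⟩
        k + ∣ A ∩ B ∣             ∎
    ; x+z≤k+y = begin
        ∣ A ∩ B ∣ + i
          ≡⟨ cong₂ _+_ (cong ∣_∣ (∩-comm A B)) (trans (sym ∣A∩C∣≡i) (cong ∣_∣ (∩-comm A C))) ⟩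
        ∣ B ∩ A ∣ + ∣ C ∩ A ∣     ≤⟨ ∣p∩r∣+∣q∩r∣≤∣r∣+∣p∩q∣ B C A ⟩
        ∣ A ∣ + ∣ B ∩ C ∣         ≡⟨ cong₂ _+_ ∣A∣≡k (cong ∣_∣ (∩-comm B C)) ⟩
        k + ∣ C ∩ B ∣             ∎
    ; 3k≤v+x+y+z = subst₂ (λ n w → n ≤ v + (∣ A ∩ B ∣ + ∣ C ∩ B ∣ + w))
        (cong₂ (λ a c → a + c) (cong₂ _+_ ∣A∣≡k ∣B∣≡k) ∣C∣≡k) ∣A∩C∣≡i
        (∣p∣+∣q∣+∣r∣≤n+∣p∩q∣+∣r∩q∣+∣p∩r∣ A B C)
    }
    where open ≤-Reasoning

  step-to-i : ∀ {t} → t ≤ k → i + i ≤ k + t → k + k + k ≤ v + (t + i + i) → Step t i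
  step-to-i t≤k 2i≤k+t cover = record
    { x+y≤k+z = +-monoˡ-≤ i t≤k
    ; y+z≤k+x = 2i≤k+t
    ; x+z≤k+y = +-monoˡ-≤ i t≤k
    ; 3k≤v+x+y+z = cover
    }

  step-up : ∀ {e t} → k + k ≤ v → i + e ≡ k → t ≤ i → Step t (t + e)
  step-up {e} {t} 2k≤v refl t≤i = record
    { x+y≤k+z = cancel-≤ 0 (+-mono-≤ (+-mono-≤ t≤i t≤i) (≤-refl {e}))
        (solve (t ∷ e ∷ [])) (solve (i ∷ e ∷ []))
    ; y+z≤k+x = ≤-reflexive (solve (t ∷ e ∷ i ∷ []))
    ; x+z≤k+y = cancel-≤ 0 (m≤m+n (t + i) (e + e)) (solve (t ∷ i ∷ [])) (solve (t ∷ i ∷ e ∷ []))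
    ; 3k≤v+x+y+z = cancel-≤ 0 (+-mono-≤ 2k≤v (m≤n+m (i + e) (t + t)))
        (solve (i ∷ e ∷ [])) (solve (v ∷ t ∷ i ∷ e ∷ []))
    }

  ReachableIn : ℕ → ℕ → Set
  ReachableIn m t = ∀ X Y → meet X Y ≡ t → DistLe _~_ X Y m

  reach-mono : ∀ {m m′ t} → m ≤ m′ → ReachableIn m t → ReachableIn m′ t
  reach-mono m≤m′ r X Y eq = let n , n≤m , w = r X Y eq in n , ≤-trans n≤m m≤m′ , w

  reach-i : ReachableIn 1 i
  reach-i X Y X~Y = 1 , ≤-refl , step X~Y here

  reach-k : ReachableIn 0 k
  reach-k (A , ∣A∣≡k) (B , ∣B∣≡k) ∣A∩B∣≡k
    with ∣p∩q∣≡∣p∣≡∣q∣⇒p≡q A B (trans ∣A∩B∣≡k (sym ∣A∣≡k)) (trans ∣A∩B∣≡k (sym ∣B∣≡k))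
  ... | refl with ≡-irrelevant ∣A∣≡k ∣B∣≡k
  ... | refl = 0 , z≤n , here

  module Connectivity (2k≤v : k + k ≤ v) where

    quotas⇒neighbour : ∀ X Y {s} → Quotas (meet X Y) s i → ∃[ Z ] X ~ Z × meet Z Y ≡ s
    quotas⇒neighbour (A , ∣A∣≡k) (B , ∣B∣≡k) record
      { a = a ; b = b ; c = c ; d = d ; a+b≡z = a+b≡i ; a+c≡y = a+c≡s ; a+b+c+d≡k = a+b+c+d≡k
      ; a≤x = a≤t ; b+x≤k = b+t≤k ; c+x≤k = c+t≤k ; d+k+k≤v+x = d+k+k≤v+t } =
      let ∣C∣≡ , ∣A∩C∣≡ , ∣C∩B∣≡ = sizes
      in (C , trans ∣C∣≡ a+b+c+d≡k) , trans ∣A∩C∣≡ a+b≡i , trans ∣C∩B∣≡ a+c≡s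
      where
      C : Subset v
      C = select A B a b c d
      sizes : ∣ C ∣ ≡ a + b + c + d × ∣ A ∩ C ∣ ≡ a + b × ∣ C ∩ B ∣ ≡ a + c
      sizes = select-sizes A B a≤t
        (≤∣p─q∣ A B (subst (b + ∣ A ∩ B ∣ ≤_) (sym ∣A∣≡k) b+t≤k))
        (≤∣p─q∣ B A (subst₂ (λ u w → c + u ≤ w) (cong ∣_∣ (∩-comm A B)) (sym ∣B∣≡k) c+t≤k))
        (≤∣∁[p∪q]∣ A B (subst (λ w → d + w ≤ v + ∣ A ∩ B ∣) (sym (cong₂ _+_ ∣A∣≡k ∣B∣≡k)) d+k+k≤v+t))

    step⇒neighbour : ∀ X Y {s} → Step (meet X Y) s → ∃[ Z ] X ~ Z × meet Z Y ≡ s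
    step⇒neighbour X Y st = quotas⇒neighbour X Y (admissible⇒quotas 2k≤v st)

    reach-step : ∀ {m t s} → Step t s → ReachableIn m s → ReachableIn (suc m) t
    reach-step st r X Y refl =
      let Z , X~Z , meet≡s = step⇒neighbour X Y st
          n , n≤m , w = r Z Y meet≡s
      in suc n , s≤s n≤m , step X~Z w

    pair-meeting : ∀ t → t ≤ k → ∃[ X ] ∃[ Y ] meet X Y ≡ t
    pair-meeting t t≤k with m≤n⇒∃[o]m+o≡n t≤k
    ... | d , t+d≡k = (A , ∣A∣≡k) , (B , ∣B∣≡k) , ∣A∩B∣≡t
      where
      k≤∣⊤∩⊤∣ : k ≤ ∣ ⊤ {v} ∩ ⊤ ∣
      k≤∣⊤∩⊤∣ = subst (k ≤_) (sym (trans (cong ∣_∣ (∩-idem (⊤ {v}))) (∣⊤∣≡n v))) (≤-trans (m≤m+n k k) 2k≤v)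
      A : Subset v
      A = select ⊤ ⊤ k 0 0 0
      k+0+0+0≡k : k + 0 + 0 + 0 ≡ k
      k+0+0+0≡k = solve (k ∷ [])
      ∣A∣≡k : ∣ A ∣ ≡ k
      ∣A∣≡k = trans (proj₁ (select-sizes (⊤ {v}) ⊤ k≤∣⊤∩⊤∣ z≤n z≤n z≤n)) k+0+0+0≡k
      ∣A∩A∣≡k : ∣ A ∩ A ∣ ≡ k
      ∣A∩A∣≡k = trans (cong ∣_∣ (∩-idem A)) ∣A∣≡k
      d+2k≤v+k : d + (k + k) ≤ v + k
      d+2k≤v+k = cancel-≤ 0 (+-mono-≤ 2k≤v (subst (d ≤_) t+d≡k (m≤n+m d t)))
        (solve (d ∷ k ∷ [])) (solve (v ∷ k ∷ []))
      B : Subset v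
      B = select A A t 0 0 d
      sizes : ∣ B ∣ ≡ t + 0 + 0 + d × ∣ A ∩ B ∣ ≡ t + 0 × ∣ B ∩ A ∣ ≡ t + 0
      sizes = select-sizes A A (subst (t ≤_) (sym ∣A∩A∣≡k) t≤k) z≤n z≤n
        (≤∣∁[p∪q]∣ A A (subst₂ (λ u w → d + (u + u) ≤ v + w) (sym ∣A∣≡k) (sym ∣A∩A∣≡k) d+2k≤v+k))
      ∣B∣≡k : ∣ B ∣ ≡ k
      ∣B∣≡k = trans (proj₁ sizes) (trans (cong (_+ d) (trans (+-identityʳ (t + 0)) (+-identityʳ t))) t+d≡k)
      ∣A∩B∣≡t : ∣ A ∩ B ∣ ≡ t
      ∣A∩B∣≡t = trans (proj₁ (proj₂ sizes)) (+-identityʳ t)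

module LargeΔ (v i e : ℕ) (0<i : 0 < i) (0<e : 0 < e) (2k≤v : (i + e) + (i + e) ≤ v)
               (3k≤v+2i : (i + e) + (i + e) + (i + e) ≤ v + (i + i)) where
  open JohnsonGraph v (i + e) i
  open Connectivity 2k≤v

  reach-two : ∀ {t} → t ≤ i + e → i ≤ t + e → ReachableIn 2 t
  reach-two {t} t≤k i≤t+e = reach-step (step-to-i t≤k 2i≤k+t cover) reach-i
    where
    2i≤k+t : i + i ≤ (i + e) + t
    2i≤k+t = cancel-≤ 0 (+-mono-≤ (≤-refl {i}) i≤t+e) (solve (i ∷ [])) (solve (i ∷ t ∷ e ∷ []))
    cover : (i + e) + (i + e) + (i + e) ≤ v + (t + i + i)
    cover = ≤-trans 3k≤v+2i
      (cancel-≤ 0 (m≤m+n (v + (i + i)) t) (solve (v ∷ i ∷ [])) (solve (v ∷ t ∷ i ∷ [])))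

  climb : ∀ j {t} → t ≤ i + e → i ≤ t + suc j * e → ReachableIn (2 + j) t
  climb zero {t} t≤k i≤t+e = reach-two t≤k (subst (λ w → i ≤ t + w) (+-identityʳ e) i≤t+e)
  climb (suc j) {t} t≤k i≤ with i ≤? t + e
  ... | yes i≤t+e = reach-mono (m≤m+n 2 (suc j)) (reach-two t≤k i≤t+e)
  ... | no i≰t+e = reach-step (step-up 2k≤v refl t≤i)
                     (climb j (+-monoˡ-≤ e t≤i) (subst (i ≤_) (sym (+-assoc t e (suc j * e))) i≤))
    where
    t≤i : t ≤ i
    t≤i = ≤-trans (m≤m+n t e) (<⇒≤ (≰⇒> i≰t+e))

  k≤t+[m+1]e : ∀ {t s m} → Step t s → i + e ≤ s + m * e → i + e ≤ t + suc m * e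
  k≤t+[m+1]e {t} {s} {m} st k≤s+me = cancel-≤ (s + i)
    (+-mono-≤ k≤s+me (Admissible.y+z≤k+x st)) (solve (i ∷ e ∷ s ∷ [])) (solve (s ∷ m ∷ e ∷ i ∷ t ∷ []))

  -- Along a walk the meet with the endpoint grows by at most e = k - i per step.
  walk-meet : ∀ {X Y m} → Walk _~_ X Y m → i + e ≤ meet X Y + m * e
  walk-meet {X} here = ≤-reflexive (sym (trans (+-identityʳ (meet X X)) (meet-self X)))
  walk-meet {X} {Y} {suc m} (step {y = Z} X~Z w) =
    k≤t+[m+1]e {m = m} (neighbour⇒step X Y Z X~Z) (walk-meet w)

  i≤t+[1+j]e : ∀ j {t} → i + e ≤ (2 + j) * e → i ≤ t + suc j * e
  i≤t+[1+j]e j {t} k≤[2+j]e =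
    cancel-≤ e (+-mono-≤ k≤[2+j]e (z≤n {t})) (solve (i ∷ e ∷ [])) (solve (e ∷ j ∷ t ∷ []))

  diameter : Diameter _~_ ⌈ i + e / e ⌉
  diameter = upper , lower
    where
    c : ℕ
    c = ⌈ i + e / e ⌉
    k≤ce : i + e ≤ c * e
    k≤ce = a≤⌈a/d⌉*d (i + e) 0<e
    2≤c : 2 ≤ c
    2≤c = ≮⇒≥ λ c<2 → <⇒≱ (≤-<-trans (*-monoˡ-≤ e (m<1+n⇒m≤n c<2)) e+0<k) k≤ce
      where
      e+0<k : e + 0 < i + e
      e+0<k = subst (_< i + e) (sym (+-identityʳ e)) (m<n+m e 0<i)
    upper : ∀ X Y → DistLe _~_ X Y c
    upper X Y =
      let j , 2+j≡c = m≤n⇒∃[o]m+o≡n 2≤c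
          k≤[2+j]e = subst (λ n → i + e ≤ n * e) (sym 2+j≡c) k≤ce
      in reach-mono (≤-reflexive 2+j≡c) (climb j (meet≤k X Y) (i≤t+[1+j]e j {meet X Y} k≤[2+j]e)) X Y refl
    lower : ∃[ X ] ∃[ Y ] (∀ m → Walk _~_ X Y m → c ≤ m)
    lower =
      let X , Y , meet≡0 = pair-meeting 0 z≤n
      in X , Y , λ m w → ⌈a/d⌉≤m (i + e) m 0<e (subst (λ t → i + e ≤ t + m * e) meet≡0 (walk-meet w))

module MediumΔ (v i e : ℕ) (0<i : 0 < i) (2k≤v : (i + e) + (i + e) ≤ v)
                  (3e≤1+v : e + e + e ≤ suc v) (v+2i<3k : v + (i + i) < (i + e) + (i + e) + (i + e)) where
  open JohnsonGraph v (i + e) i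
  open Connectivity 2k≤v

  i<e : i < e
  i<e = cancel-≤ (v + (i + i) + (i + e) + e) (+-mono-≤ 2k≤v v+2i<3k)
    (solve (i ∷ v ∷ e ∷ [])) (solve (v ∷ i ∷ e ∷ []))

  reach-two : ∀ {t} → i < t → t ≤ i + e → ReachableIn 2 t
  reach-two {t} i<t t≤k = reach-step (step-to-i t≤k 2i≤k+t cover) reach-i
    where
    2i≤k+t : i + i ≤ (i + e) + t
    2i≤k+t = cancel-≤ 0 (+-mono-≤ (≤-refl {i}) (≤-trans (<⇒≤ i<t) (m≤n+m t e)))
      (solve (i ∷ [])) (solve (i ∷ e ∷ t ∷ []))
    cover : (i + e) + (i + e) + (i + e) ≤ v + (t + i + i)
    cover = cancel-≤ 1 (+-mono-≤ 3e≤1+v (+-mono-≤ i<t (≤-refl {i + i})))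
      (solve (i ∷ e ∷ [])) (solve (v ∷ t ∷ i ∷ []))

  upper : ∀ X Y → DistLe _~_ X Y 3
  upper X Y with <-cmp i (meet X Y)
  ... | tri< i<t _ _ = reach-mono (n≤1+n 2) (reach-two i<t (meet≤k X Y)) X Y refl
  ... | tri≈ _ i≡t _ = reach-mono (s≤s z≤n) reach-i X Y (sym i≡t)
  ... | tri> _ _ t<i = reach-step (step-up 2k≤v refl (<⇒≤ t<i))
          (reach-two (≤-trans i<e (m≤n+m e (meet X Y))) (+-monoˡ-≤ e (<⇒≤ t<i))) X Y refl

  disjoint⇒3≤length : ∀ {X Y m} → meet X Y ≡ 0 → Walk _~_ X Y m → 3 ≤ m
  disjoint⇒3≤length {X} meet≡0 here =
    contradiction (trans (sym (meet-self X)) meet≡0) (<⇒≢ (≤-trans 0<i (m≤m+n i e)) ∘ sym)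
  disjoint⇒3≤length meet≡0 (step X~Y here) = contradiction (trans (sym X~Y) meet≡0) (<⇒≢ 0<i ∘ sym)
  disjoint⇒3≤length {X} {Y} meet≡0 (step {y = Z} X~Z (step Z~Y here)) =
    ⊥-elim (<⇒≱ v+2i<3k (subst₂ (λ t s → (i + e) + (i + e) + (i + e) ≤ v + (t + s + i)) meet≡0 Z~Y
      (Admissible.3k≤v+x+y+z (neighbour⇒step X Y Z X~Z))))
  disjoint⇒3≤length _ (step _ (step _ (step _ _))) = s≤s (s≤s (s≤s z≤n))

  diameter : Diameter _~_ 3
  diameter =
    let X , Y , meet≡0 = pair-meeting 0 z≤n
    in upper , X , Y , λ m → disjoint⇒3≤length meet≡0

-- Here k = i + 1 + e and v = 2 (k - i) + D, so D is the Δ of the statement and q = ⌈ e / D ⌉.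
module SmallΔ (i e D : ℕ) (2i≤D : i + i ≤ D) (0<D : 0 < D) (D<e⊎i≡0 : D < e ⊎ i ≡ 0) where
  open JohnsonGraph (suc e + suc e + D) (i + suc e) i

  2k≤v : (i + suc e) + (i + suc e) ≤ suc e + suc e + D
  2k≤v = cancel-≤ 0 (+-mono-≤ (≤-refl {suc e + suc e}) 2i≤D) (solve (i ∷ e ∷ [])) (solve (e ∷ D ∷ []))

  open Connectivity 2k≤v

  i≤1+e : i ≤ suc e
  i≤1+e = [ (λ D<e → ≤-trans (m≤m+n i i) (≤-trans 2i≤D (≤-trans (<⇒≤ D<e) (n≤1+n e))))
          , (λ i≡0 → subst (_≤ suc e) (sym i≡0) z≤n) ]′ D<e⊎i≡0

  -- Vertices meeting in t points are at distance ≤ 2j iff EvenWithin j t, and at distance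
  -- ≤ 2j + 1 iff OddWithin j t.
  EvenWithin OddWithin : ℕ → ℕ → Set
  EvenWithin j t = i + suc e ≤ t + j * D
  OddWithin j t = t ≤ i + j * D × i ≤ t + j * D

  odd-within-of-step : ∀ {j t s} → Step t s → EvenWithin j s → OddWithin j t
  odd-within-of-step {j} {t} {s} st k≤s+jD =
      cancel-≤ (s + (i + suc e)) (+-mono-≤ x+y≤k+z k≤s+jD)
        (solve (t ∷ s ∷ i ∷ e ∷ j ∷ D ∷ [])) (solve (t ∷ s ∷ i ∷ e ∷ j ∷ D ∷ []))
    , cancel-≤ (s + (i + suc e)) (+-mono-≤ y+z≤k+x k≤s+jD)
        (solve (t ∷ s ∷ i ∷ e ∷ j ∷ D ∷ [])) (solve (t ∷ s ∷ i ∷ e ∷ j ∷ D ∷ []))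
    where open Admissible st

  even-within-of-step : ∀ {j t s} → Step t s → OddWithin j s → EvenWithin (suc j) t
  even-within-of-step {j} {t} {s} st (s≤i+jD , _) =
    cancel-≤ ((i + suc e) + (i + suc e) + s) (+-mono-≤ (Admissible.3k≤v+x+y+z st) s≤i+jD)
      (solve (t ∷ s ∷ i ∷ e ∷ j ∷ D ∷ [])) (solve (t ∷ s ∷ i ∷ e ∷ j ∷ D ∷ []))

  step-towards-k : ∀ {j t} → t ≤ i + suc e → OddWithin j t → ∃[ s ] Step t s × EvenWithin j s
  step-towards-k {j} {t} t≤k (t≤i+jD , i≤t+jD) with ≤-total t i
  ... | inj₁ t≤i = t + suc e , step-up 2k≤v refl t≤i ,
    cancel-≤ 0 (+-mono-≤ i≤t+jD (≤-refl {suc e}))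
      (solve (t ∷ i ∷ e ∷ j ∷ D ∷ [])) (solve (t ∷ i ∷ e ∷ j ∷ D ∷ []))
  ... | inj₂ i≤t =
    let s , t+s≡i+k = m≤n⇒∃[o]m+o≡n (≤-trans t≤k (m≤n+m (i + suc e) i))
    in s , reflect s t+s≡i+k , even-within s t+s≡i+k
    where
    even-within : ∀ s → t + s ≡ i + (i + suc e) → EvenWithin j s
    even-within s t+s≡i+k = cancel-≤ (t + i) (+-mono-≤ t≤i+jD (≤-reflexive (sym t+s≡i+k)))
      (solve (t ∷ i ∷ e ∷ [])) (solve (t ∷ s ∷ i ∷ j ∷ D ∷ []))
    reflect : ∀ s → t + s ≡ i + (i + suc e) → Step t s
    reflect s t+s≡i+k = record
      { x+y≤k+z = ≤-reflexive (trans t+s≡i+k (+-comm i (i + suc e)))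
      ; y+z≤k+x = cancel-≤ (t + i) (+-mono-≤ (≤-reflexive t+s≡i+k) (+-mono-≤ i≤t i≤t))
          (solve (t ∷ s ∷ i ∷ [])) (solve (t ∷ i ∷ e ∷ []))
      ; x+z≤k+y = cancel-≤ (t + (i + suc e)) (+-mono-≤ (+-mono-≤ t≤k t≤k) (≤-reflexive (sym t+s≡i+k)))
          (solve (t ∷ i ∷ e ∷ [])) (solve (t ∷ s ∷ i ∷ e ∷ []))
      ; 3k≤v+x+y+z = subst (λ w → (i + suc e) + (i + suc e) + (i + suc e) ≤ suc e + suc e + D + (w + i))
          (sym t+s≡i+k) (cancel-≤ 0 (m≤m+n ((i + suc e) + (i + suc e) + (i + suc e)) D)
            (solve (i ∷ e ∷ [])) (solve (i ∷ e ∷ D ∷ [])))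
      }

  step-towards-i : ∀ {j t} → t ≤ i + suc e → EvenWithin (suc j) t → ∃[ s ] Step t s × OddWithin j s
  step-towards-i {j} {t} t≤k k≤t+D+jD with i + suc e ≤? t + D
  ... | yes k≤t+D = i , step-to-i t≤k 2i≤k+t cover , m≤m+n i (j * D) , m≤m+n i (j * D)
    where
    2i≤k+t : i + i ≤ (i + suc e) + t
    2i≤k+t = cancel-≤ 0 (+-mono-≤ (+-mono-≤ (≤-refl {i}) i≤1+e) (z≤n {t}))
      (solve (i ∷ [])) (solve (t ∷ i ∷ e ∷ []))
    cover : (i + suc e) + (i + suc e) + (i + suc e) ≤ suc e + suc e + D + (t + i + i)
    cover = cancel-≤ 0 (+-mono-≤ (≤-refl {(i + suc e) + (i + suc e)}) k≤t+D)
      (solve (i ∷ e ∷ [])) (solve (t ∷ i ∷ e ∷ D ∷ []))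
  ... | no k≰t+D =
    let d , t+D+d≡k = m≤n⇒∃[o]m+o≡n (<⇒≤ (≰⇒> k≰t+D))
    in i + d , lift d t+D+d≡k , odd-within d t+D+d≡k
    where
    odd-within : ∀ d → t + D + d ≡ i + suc e → OddWithin j (i + d)
    odd-within d t+D+d≡k =
      cancel-≤ (t + D + suc e) (+-mono-≤ (≤-reflexive t+D+d≡k) k≤t+D+jD)
        (solve (t ∷ d ∷ i ∷ e ∷ D ∷ [])) (solve (t ∷ i ∷ e ∷ j ∷ D ∷ [])) ,
      ≤-trans (m≤m+n i d) (m≤m+n (i + d) (j * D))
    lift : ∀ d → t + D + d ≡ i + suc e → Step t (i + d)
    lift d t+D+d≡k = record
      { x+y≤k+z = cancel-≤ D (+-mono-≤ (≤-reflexive t+D+d≡k) (m≤m+n i D))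
          (solve (t ∷ i ∷ d ∷ D ∷ [])) (solve (i ∷ e ∷ D ∷ []))
      ; y+z≤k+x = subst (λ w → i + d + i ≤ w + t) t+D+d≡k
          (cancel-≤ 0 (+-mono-≤ 2i≤D (m≤m+n d (t + t))) (solve (i ∷ d ∷ [])) (solve (t ∷ d ∷ D ∷ [])))
      ; x+z≤k+y = +-mono-≤ t≤k (m≤m+n i d)
      ; 3k≤v+x+y+z = subst (λ w → (i + suc e) + (i + suc e) + w ≤ suc e + suc e + D + (t + (i + d) + i))
          t+D+d≡k (≤-reflexive (solve (t ∷ i ∷ d ∷ e ∷ D ∷ [])))
      }

  reach-even : ∀ j {t} → t ≤ i + suc e → EvenWithin j t → ReachableIn (j + j) t
  reach-odd : ∀ j {t} → t ≤ i + suc e → OddWithin j t → ReachableIn (suc (j + j)) t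

  reach-even zero {t} t≤k k≤t+0 =
    subst (ReachableIn 0) (≤-antisym (subst (i + suc e ≤_) (+-identityʳ t) k≤t+0) t≤k) reach-k
  reach-even (suc j) {t} t≤k w =
    let s , st , w′ = step-towards-i {j} t≤k w
    in subst (λ m → ReachableIn m t) (cong suc (sym (+-suc j j)))
         (reach-step st (reach-odd j (admissible⇒y≤k st) w′))
  reach-odd j t≤k w =
    let s , st , w′ = step-towards-k {j} t≤k w
    in reach-step st (reach-even j (admissible⇒y≤k st) w′)

  walk-even : ∀ j {X Y} → Walk _~_ X Y (j + j) → EvenWithin j (meet X Y)
  walk-odd : ∀ j {X Y} → Walk _~_ X Y (suc (j + j)) → OddWithin j (meet X Y)

  walk-even zero {X} here = ≤-reflexive (sym (trans (+-identityʳ (meet X X)) (meet-self X)))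
  walk-even (suc j) {X} {Y} (step {y = Z} X~Z w) =
    even-within-of-step {j} (neighbour⇒step X Y Z X~Z) (walk-odd j (subst (Walk _~_ Z Y) (+-suc j j) w))
  walk-odd j {X} {Y} (step {y = Z} X~Z w) = odd-within-of-step {j} (neighbour⇒step X Y Z X~Z) (walk-even j w)

  q : ℕ
  q = ⌈ e / D ⌉

  e≤qD : e ≤ q * D
  e≤qD = a≤⌈a/d⌉*d e 0<D

  i≡0⊎2≤q : i ≡ 0 ⊎ 2 ≤ q
  i≡0⊎2≤q = [ (λ D<e → inj₂ (≮⇒≥ λ q<2 → <⇒≱ D<e (≤-trans e≤qD (qD≤D q<2)))) , inj₁ ]′ D<e⊎i≡0
    where
    qD≤D : q < 2 → q * D ≤ D
    qD≤D q<2 = ≤-trans (*-monoˡ-≤ D (m<1+n⇒m≤n q<2)) (≤-reflexive (+-identityʳ D))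

  even-or-odd-within : ∀ h h′ {t} → i ≡ 0 ⊎ 1 ≤ h → e ≤ (h + h′) * D → EvenWithin h′ t ⊎ OddWithin h t
  even-or-odd-within h h′ {t} i≡0⊎1≤h e≤[h+h′]D with i + suc e ≤? t + h′ * D
  ... | yes k≤t+h′D = inj₁ k≤t+h′D
  ... | no k≰t+h′D = inj₂ (t≤i+hD , i≤t+hD)
    where
    t≤i+hD : t ≤ i + h * D
    t≤i+hD = cancel-≤ (suc (h′ * D + e)) (+-mono-≤ (≰⇒> k≰t+h′D) e≤[h+h′]D)
      (solve (t ∷ h′ ∷ D ∷ e ∷ [])) (solve (i ∷ e ∷ h ∷ h′ ∷ D ∷ []))
    i≤t+hD : i ≤ t + h * D
    i≤t+hD = [ (λ i≡0 → subst (_≤ t + h * D) (sym i≡0) z≤n)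
             , (λ 1≤h → ≤-trans (m≤m+n i i) (≤-trans 2i≤D (≤-trans (D≤hD 1≤h) (m≤n+m (h * D) t)))) ]′ i≡0⊎1≤h
      where
      D≤hD : 1 ≤ h → D ≤ h * D
      D≤hD 1≤h = ≤-trans (≤-reflexive (sym (+-identityʳ D))) (*-monoˡ-≤ D 1≤h)

  reach-within-q+1 : ∀ h {t} → h + h ≤ q → q ≤ suc (h + h) → t ≤ i + suc e → ReachableIn (q + 1) t
  reach-within-q+1 h h+h≤q q≤1+2h t≤k =
    let h′ , h+h′≡q = m≤n⇒∃[o]m+o≡n (≤-trans (m≤m+n h h) h+h≤q)
    in [ (λ w → reach-mono (h′+h′≤n+1 h h′ h+h′≡q q≤1+2h) (reach-even h′ t≤k w))
       , (λ w → reach-mono (subst (suc (h + h) ≤_) (+-comm 1 q) (s≤s h+h≤q)) (reach-odd h t≤k w)) ]′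
       (even-or-odd-within h h′ ([ inj₁ , (λ 2≤q → inj₂ (1≤h (≤-trans 2≤q q≤1+2h))) ]′ i≡0⊎2≤q)
                            (subst (λ n → e ≤ n * D) (sym h+h′≡q) e≤qD))
    where
    1≤h : ∀ {h} → 2 ≤ suc (h + h) → 1 ≤ h
    1≤h {zero} (s≤s ())
    1≤h {suc h} _ = s≤s z≤n
    h′+h′≤n+1 : ∀ h h′ {n} → h + h′ ≡ n → n ≤ suc (h + h) → h′ + h′ ≤ n + 1
    h′+h′≤n+1 h h′ refl n≤1+2h = cancel-≤ (h + h) (+-mono-≤ (≤-refl {h + h′}) n≤1+2h)
      (solve (h ∷ h′ ∷ [])) (solve (h ∷ h′ ∷ []))

  1+hD≤k : ∀ h → h + h ≤ q → suc (h * D) ≤ i + suc e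
  1+hD≤k zero _ = ≤-trans (s≤s z≤n) (m≤n+m (suc e) i)
  1+hD≤k (suc h) h+h≤q = ≤-trans [1+h]D<e (≤-trans (n≤1+n e) (m≤n+m (suc e) i))
    where
    [2+2h]D<e+D : (suc h + suc h) * D < e + D
    [2+2h]D<e+D = ≤-<-trans (*-monoˡ-≤ D h+h≤q) (⌈a/d⌉*d<a+d e 0<D)
    D≤[1+h]D : D ≤ suc h * D
    D≤[1+h]D = m≤m+n D (h * D)
    [1+h]D<e : suc h * D < e
    [1+h]D<e = cancel-≤ (suc h * D + D) (+-mono-≤ [2+2h]D<e+D D≤[1+h]D)
      (solve (h ∷ D ∷ [])) (solve (e ∷ h ∷ D ∷ []))

  q+1≤even-length : ∀ h j {t} → q ≤ suc (h + h) → t + suc (h * D) ≡ i + suc e → EvenWithin j t → q + 1 ≤ j + j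
  q+1≤even-length h j {t} q≤1+2h gap k≤t+jD = n+1≤j+j q q≤1+2h
    where
    hD<jD : h * D < j * D
    hD<jD = +-cancelˡ-≤ t _ _ (subst (_≤ t + j * D) (sym gap) k≤t+jD)
    h<j : h < j
    h<j = ≰⇒> (λ j≤h → <⇒≱ hD<jD (*-monoˡ-≤ D j≤h))
    n+1≤j+j : ∀ n → n ≤ suc (h + h) → n + 1 ≤ j + j
    n+1≤j+j n n≤1+2h = cancel-≤ (suc (h + h)) (+-mono-≤ n≤1+2h (+-mono-≤ h<j h<j))
      (solve (n ∷ h ∷ [])) (solve (h ∷ j ∷ []))

  q+1≤odd-length : ∀ h j {t} → h + h ≤ q → t + suc (h * D) ≡ i + suc e → t ≤ i + j * D → q + 1 ≤ suc (j + j)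
  q+1≤odd-length h j {t} h+h≤q gap t≤i+jD = subst (_≤ suc (j + j)) (+-comm 1 q) (s≤s q≤j+j)
    where
    e≤[j+h]D : e ≤ (j + h) * D
    e≤[j+h]D = cancel-≤ (suc (i + t)) (+-mono-≤ (≤-reflexive (sym gap)) t≤i+jD)
      (solve (e ∷ i ∷ t ∷ [])) (solve (t ∷ h ∷ D ∷ i ∷ j ∷ []))
    q≤j+h : q ≤ j + h
    q≤j+h = ⌈a/d⌉≤m e (j + h) 0<D e≤[j+h]D
    q≤j+j : q ≤ j + j
    q≤j+j = ≤-trans q≤j+h (+-monoʳ-≤ j (+-cancelʳ-≤ h h j (≤-trans h+h≤q q≤j+h)))

  q+1≤length : ∀ h {t} → h + h ≤ q → q ≤ suc (h + h) → t + suc (h * D) ≡ i + suc e →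
              ∀ {X Y m} → meet X Y ≡ t → Walk _~_ X Y m → q + 1 ≤ m
  q+1≤length h h+h≤q q≤1+2h gap {X} {Y} {m} meet≡t w with halving m
  ... | even j = q+1≤even-length h j q≤1+2h gap (subst (EvenWithin j) meet≡t (walk-even j w))
  ... | odd j = q+1≤odd-length h j h+h≤q gap (subst (λ u → u ≤ i + j * D) meet≡t (proj₁ (walk-odd j w)))

  diameter : Diameter _~_ (q + 1)
  diameter = upper , lower
    where
    h : ℕ
    h = proj₁ (halving-bounds q)
    h+h≤q : h + h ≤ q
    h+h≤q = proj₁ (proj₂ (halving-bounds q))
    q≤1+2h : q ≤ suc (h + h)
    q≤1+2h = proj₂ (proj₂ (halving-bounds q))
    upper : ∀ X Y → DistLe _~_ X Y (q + 1)
    upper X Y = reach-within-q+1 h h+h≤q q≤1+2h (meet≤k X Y) X Y refl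
    lower : ∃[ X ] ∃[ Y ] (∀ m → Walk _~_ X Y m → q + 1 ≤ m)
    lower =
      let t , 1+hD+t≡k = m≤n⇒∃[o]m+o≡n (1+hD≤k h h+h≤q)
          X , Y , meet≡t = pair-meeting t (≤-trans (m≤n+m t (suc (h * D))) (≤-reflexive 1+hD+t≡k))
      in X , Y , λ m → q+1≤length h h+h≤q q≤1+2h (trans (+-comm t _) 1+hD+t≡k) meet≡t

2*k≤v⇒k+k≤v : ∀ k {v} → 2 * k ≤ v → k + k ≤ v
2*k≤v⇒k+k≤v k {v} = subst (_≤ v) (cong (k +_) (+-identityʳ k))

e+e≤v : ∀ v i e → 2 * (i + e) ≤ v → e + e ≤ v
e+e≤v v i e 2k≤v = cancel-≤ (i + i) (+-mono-≤ 2k≤v (z≤n {i + i})) (solve (i ∷ e ∷ [])) (solve (v ∷ i ∷ []))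

small-Δ-case : ∀ v i e → 2 * (i + suc e) ≤ v → ¬ (v ≡ 2 * (i + suc e) × i ≡ 0) →
  (v < 3 * (i + suc e ∸ i) ∸ 1 ⊎ i ≡ 0) →
  Diameter (JAdj v (i + suc e) i) (⌈ i + suc e ∸ i ∸ 1 / (v + 2 * i ∸ 2 * (i + suc e)) ⌉ + 1)
small-Δ-case v i e 2k≤v nondegenerate small with m≤n⇒∃[o]m+o≡n (e+e≤v v i (suc e) 2k≤v)
... | D , refl = subst (Diameter (JAdj _ (i + suc e) i)) q+1≡
                   (SmallΔ.diameter i e D 2i≤D (nondegenerate⇒0<D i D 2i≤D nondegenerate) (map₁ D<e small))
  where
  2i≤D : i + i ≤ D
  2i≤D = cancel-≤ (suc e + suc e) 2k≤v (solve (i ∷ e ∷ [])) (solve (e ∷ D ∷ []))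
  nondegenerate⇒0<D : ∀ i D → i + i ≤ D → ¬ (suc e + suc e + D ≡ 2 * (i + suc e) × i ≡ 0) → 0 < D
  nondegenerate⇒0<D zero zero _ nondegenerate = ⊥-elim (nondegenerate (solve (e ∷ []) , refl))
  nondegenerate⇒0<D zero (suc D) _ _ = s≤s z≤n
  nondegenerate⇒0<D (suc i) D 2i≤D _ = ≤-trans (s≤s z≤n) 2i≤D
  D<e : suc e + suc e + D < 3 * (i + suc e ∸ i) ∸ 1 → D < e
  D<e v<3[k-i]-1 = cancel-≤ (suc e + suc e) v<e+2[e+1] (solve (e ∷ D ∷ [])) (solve (e ∷ []))
    where
    v<e+2[e+1] : suc e + suc e + D < e + (suc e + (suc e + 0))
    v<e+2[e+1] = subst (λ n → suc e + suc e + D < 3 * n ∸ 1) (m+n∸m≡n i (suc e)) v<3[k-i]-1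
  q+1≡ : ⌈ e / D ⌉ + 1 ≡ ⌈ i + suc e ∸ i ∸ 1 / (suc e + suc e + D + 2 * i ∸ 2 * (i + suc e)) ⌉ + 1
  q+1≡ = cong₂ (λ a b → ⌈ a / b ⌉ + 1) (cong (_∸ 1) (sym (m+n∸m≡n i (suc e)))) (sym Δ≡D)
    where
    v+2i≡D+2k : suc e + suc e + D + 2 * i ≡ D + 2 * (i + suc e)
    v+2i≡D+2k = solve (i ∷ e ∷ D ∷ [])
    Δ≡D : suc e + suc e + D + 2 * i ∸ 2 * (i + suc e) ≡ D
    Δ≡D = trans (cong (_∸ 2 * (i + suc e)) v+2i≡D+2k) (m+n∸n≡m D (2 * (i + suc e)))

medium-Δ-case : ∀ v i e → 2 * (i + e) ≤ v → 3 * (i + e ∸ i) ∸ 1 ≤ v → v < 3 * (i + e) ∸ 2 * i →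
  i ≢ 0 → Diameter (JAdj v (i + e) i) 3
medium-Δ-case v i e 2k≤v 3[k-i]-1≤v v<3k-2i i≢0 =
  MediumΔ.diameter v i e (n≢0⇒n>0 i≢0) (2*k≤v⇒k+k≤v (i + e) 2k≤v) 3e≤1+v v+2i<3k
  where
  3e≤1+v : e + e + e ≤ suc v
  3e≤1+v = cancel-≤ 0 (≤-trans (m≤n+m∸n (3 * e) 1) (s≤s 3e-1≤v)) (solve (e ∷ [])) (solve (v ∷ []))
    where
    3e-1≤v : 3 * e ∸ 1 ≤ v
    3e-1≤v = subst (λ n → 3 * n ∸ 1 ≤ v) (m+n∸m≡n i e) 3[k-i]-1≤v
  v+2i<3k : v + (i + i) < (i + e) + (i + e) + (i + e)
  v+2i<3k = cancel-≤ 0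
    (subst (suc v + 2 * i ≤_) (m∸n+n≡m 2i≤3k) (+-mono-≤ v<3k-2i (≤-refl {2 * i})))
    (solve (v ∷ i ∷ [])) (solve (i ∷ e ∷ []))
    where
    2i≤3k : 2 * i ≤ 3 * (i + e)
    2i≤3k = cancel-≤ 0 (m≤m+n (i + i) (i + e + e + e)) (solve (i ∷ [])) (solve (i ∷ e ∷ []))

large-Δ-case : ∀ v i e → 0 < e → 2 * (i + e) ≤ v → 3 * (i + e) ∸ 2 * i ≤ v → i ≢ 0 →
  Diameter (JAdj v (i + e) i) ⌈ i + e / (i + e ∸ i) ⌉
large-Δ-case v i e 0<e 2k≤v 3k-2i≤v i≢0 =
  subst (λ d → Diameter (JAdj v (i + e) i) ⌈ i + e / d ⌉) (sym (m+n∸m≡n i e))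
    (LargeΔ.diameter v i e (n≢0⇒n>0 i≢0) 0<e (2*k≤v⇒k+k≤v (i + e) 2k≤v) 3k≤v+2i)
  where
  3k≤v+2i : (i + e) + (i + e) + (i + e) ≤ v + (i + i)
  3k≤v+2i = cancel-≤ 0 (≤-trans (m≤n+m∸n (3 * (i + e)) (2 * i)) (+-mono-≤ (≤-refl {2 * i}) 3k-2i≤v))
    (solve (i ∷ e ∷ [])) (solve (v ∷ i ∷ []))

theorem4p4 : (v k i : ℕ) → k < v → i < k → v ≥ 2 * k → ¬ (v ≡ 2 * k × i ≡ 0) →
    ((v < 3 * (k ∸ i) ∸ 1 ⊎ i ≡ 0) →
      Diameter (JAdj v k i) (⌈ k ∸ i ∸ 1 / (v + 2 * i ∸ 2 * k) ⌉ + 1)) ×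
    ((3 * (k ∸ i) ∸ 1 ≤ v × v < 3 * k ∸ 2 * i × i ≢ 0) →
      Diameter (JAdj v k i) 3) ×
    ((v ≥ 3 * k ∸ 2 * i × i ≢ 0) →
      Diameter (JAdj v k i) ⌈ k / (k ∸ i) ⌉)
theorem4p4 v k i _ i<k 2k≤v nondegenerate with m≤n⇒∃[o]m+o≡n (<⇒≤ i<k)
... | zero , refl = contradiction i<k (<-irrefl (sym (+-identityʳ i)))
... | suc e , refl =
  small-Δ-case v i e 2k≤v nondegenerate ,
  (λ (3[k-i]-1≤v , v<3k-2i , i≢0) → medium-Δ-case v i (suc e) 2k≤v 3[k-i]-1≤v v<3k-2i i≢0) ,
  (λ (3k-2i≤v , i≢0) → large-Δ-case v i (suc e) (s≤s z≤n) 2k≤v 3k-2i≤v i≢0)
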